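{- Let $m$ be an odd positive integer with $m\equiv 3\pmod 4$, and let $n\ge 2$ be even. Then the number $N(n,m)$ of necklaces of length $n$ over an alphabet of size $m$ is even.
   Context: A necklace of length $n$ over $\Sigma_m=\{0,\dots,m-1\}$ is an orbit of $\Sigma_m^n$ under the cyclic shift $\sigma(x_1,\dots,x_n)=(x_2,\dots,x_n,x_1)$, i.e. an equivalence class of strings under cyclic rotation. $N(n,m)$ denotes the number of such orbits; equivalently $N(n,m)=\frac1n\sum_{k=0}^{n-1}m^{\gcd(k,n)}$. -}

module Defs where

open import Data.Nat using (ℕ; zero; suc; _+_; _*_)
open import Data.Nat.Properties using (_≟_)
open import Data.List using (List; []; _∷_; _++_; map; concatMap; length; upTo)
open import Data.Bool.ListAction using (any)
open import Data.List.Properties using (≡-dec)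
open import Data.Bool using (Bool; true; false)
open import Relation.Nullary.Decidable using (⌊_⌋)

words : ℕ → ℕ → List (List ℕ)
words zero    m = [] ∷ []
words (suc n) m = concatMap (λ a → map (a ∷_) (words n m)) (upTo m)

shift : List ℕ → List ℕ
shift []       = []
shift (x ∷ xs) = xs ++ (x ∷ [])

shiftⁿ : ℕ → List ℕ → List ℕ
shiftⁿ zero    w = w
shiftⁿ (suc k) w = shift (shiftⁿ k w)

_==_ : List ℕ → List ℕ → Bool
u == v = ⌊ ≡-dec _≟_ u v ⌋

-- u and v lie in the same orbit under the cyclic shift (k ranges over 0..length-1,
-- which covers the whole cyclic group generated by σ).
sameOrbit : List ℕ → List ℕ → Bool
sameOrbit u v = any (λ k → shiftⁿ k u == v) (upTo (length u))

-- Number of orbits of a list of strings: count the elements that are the first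
-- member of their orbit in the list.
countOrbits : List (List ℕ) → ℕ
countOrbits ws = go [] ws
  where
  go : List (List ℕ) → List (List ℕ) → ℕ
  go seen []       = 0
  go seen (w ∷ ws) with any (sameOrbit w) seen
  ... | true  = go seen ws
  ... | false = suc (go (w ∷ seen) ws)

-- N(n,m): number of necklaces of length n over Σ_m, i.e. the number of orbits
-- of Σ_m^n under the cyclic shift.
N : ℕ → ℕ → ℕ
N n m = countOrbits (words n m)

{-# OPTIONS --safe #-}
-- Orbits of the cyclic shift are either achiral (w ∼ reverse w) or come in pairs {O, reverse O},
-- so N(n,m) ≡ A (mod 2) for the number A of achiral orbits. Weighting every word by the size of
-- its stabiliser gives each orbit total weight n, which turns orbit counts into word counts:
-- n·A = Σ_{j<n} c_j, where c_j counts the words w with σʲ w = reverse w. For n = 2h the sequence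
-- c_j has period 2, c_0 = m^h counts the palindromes of length 2h and c_1 = m·m^h, so
-- 2A = (m+1)·m^h, and A is even because 4 divides m+1.
module Submission where

open import Defs
open import Data.Bool using (Bool; true; false; not; _∧_; if_then_else_)
open import Data.Bool.ListAction using (any; or)
open import Data.Bool.Properties using (T-≡; T-not-≡; ⇔→≡; ∨-conicalˡ; ∨-conicalʳ)
open import Data.List as List
  using (List; []; _∷_; [_]; _++_; _∷ʳ_; map; concatMap; length; upTo; applyUpTo; reverse; take; drop)
open import Data.List.Properties
  using ( ≡-dec; ∷-injective; ∷ʳ-injective; ∷ʳ-injectiveˡ; ++-assoc; ++-identityʳ; ++-conicalʳ; length-++
        ; map-cong; map-upTo; length-upTo; upTo-∷ʳ; take++drop≡id; drop-drop; length-drop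
        ; reverse-++; unfold-reverse; reverse-involutive; length-reverse )
open import Data.List.Membership.Propositional using (_∈_; find; lose)
open import Data.List.Membership.Propositional.Properties
  using (∈-upTo⁺; ∈-upTo⁻; ∈-map⁺; ∈-map⁻; ∈-concatMap⁺; ∈-concatMap⁻)
open import Data.List.Relation.Unary.All using (All; []; _∷_; tabulate) renaming (lookup to lookupᴬ)
open import Data.List.Relation.Unary.All.Properties using (∷ʳ⁺; ++⁺; drop⁺)
open import Data.List.Relation.Unary.Any using (here; there)
open import Data.List.Relation.Unary.Any.Properties using (any⁺; any⁻; reverse⁻)
open import Data.Nat using (ℕ; zero; suc; _+_; _*_; _∸_; _^_; _≤_; _<_; _%_; _/_; _≡ᵇ_; _<ᵇ_; z≤n; s≤s; NonZero; >-nonZero)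
open import Data.Nat.Properties
open import Algebra.Properties.CommutativeSemigroup +-commutativeSemigroup using (interchange)
open import Data.Nat.DivMod using (m≡m%n+[m/n]*n; m%n<n)
open import Data.Nat.Divisibility using (_∣_; divides; ∣m∣n⇒∣m+n; m∣m*n)
open import Data.Nat.Tactic.RingSolver using (solve-∀)
open import Data.Product using (∃-syntax; _×_; _,_; proj₁; proj₂)
open import Function using (_∘_)
open import Function.Bundles using (mk⇔; Equivalence)
open import Relation.Binary.PropositionalEquality using (_≡_; _≢_; refl; sym; trans; cong; cong₂; subst; module ≡-Reasoning)
open import Relation.Nullary using (Dec; yes; no; contradiction)
open import Relation.Nullary.Decidable
  using (does; isYes; dec-true; dec-false; does-⇔; isYes≗does; toWitness; fromWitness; fromWitnessFalse)
open ≡-Reasoning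

private
  variable
    A B : Set

Word : Set
Word = List ℕ

𝟙 : Bool → ℕ
𝟙 true  = 1
𝟙 false = 0

∑ : List A → (A → ℕ) → ℕ
∑ []       f = 0
∑ (x ∷ xs) f = f x + ∑ xs f

infixl 10 ∑
syntax ∑ xs (λ x → e) = ∑[ x ∈ xs ] e

∑-cong : ∀ (xs : List A) {f g : A → ℕ} → (∀ {x} → x ∈ xs → f x ≡ g x) → ∑ xs f ≡ ∑ xs g
∑-cong []       eq = refl
∑-cong (x ∷ xs) eq = cong₂ _+_ (eq (here refl)) (∑-cong xs (eq ∘ there))

∑-++ : ∀ (xs ys : List A) (f : A → ℕ) → ∑ (xs ++ ys) f ≡ ∑ xs f + ∑ ys f
∑-++ []       ys f = refl
∑-++ (x ∷ xs) ys f = trans (cong (f x +_) (∑-++ xs ys f)) (sym (+-assoc (f x) _ _))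

∑-map : ∀ (g : A → B) xs (f : B → ℕ) → ∑ (map g xs) f ≡ ∑ xs (f ∘ g)
∑-map g []       f = refl
∑-map g (x ∷ xs) f = cong (f (g x) +_) (∑-map g xs f)

∑-concatMap : ∀ (F : A → List B) xs (f : B → ℕ) → ∑ (concatMap F xs) f ≡ ∑[ x ∈ xs ] ∑ (F x) f
∑-concatMap F []       f = refl
∑-concatMap F (x ∷ xs) f = trans (∑-++ (F x) _ f) (cong (∑ (F x) f +_) (∑-concatMap F xs f))

∑-distrib-+ : ∀ (xs : List A) (f g : A → ℕ) → ∑[ x ∈ xs ] (f x + g x) ≡ ∑ xs f + ∑ xs g
∑-distrib-+ []       f g = refl
∑-distrib-+ (x ∷ xs) f g =
  trans (cong (f x + g x +_) (∑-distrib-+ xs f g)) (interchange (f x) (g x) _ _)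

*-distribˡ-∑ : ∀ c (xs : List A) (f : A → ℕ) → c * ∑ xs f ≡ ∑[ x ∈ xs ] (c * f x)
*-distribˡ-∑ c []       f = *-zeroʳ c
*-distribˡ-∑ c (x ∷ xs) f = trans (*-distribˡ-+ c (f x) _) (cong (c * f x +_) (*-distribˡ-∑ c xs f))

*-distribʳ-∑ : ∀ c (xs : List A) (f : A → ℕ) → ∑ xs f * c ≡ ∑[ x ∈ xs ] (f x * c)
*-distribʳ-∑ c xs f = begin
  ∑ xs f * c              ≡⟨ *-comm (∑ xs f) c ⟩
  c * ∑ xs f              ≡⟨ *-distribˡ-∑ c xs f ⟩
  ∑[ x ∈ xs ] (c * f x)   ≡⟨ ∑-cong xs (λ {x} _ → *-comm c (f x)) ⟩
  ∑[ x ∈ xs ] (f x * c)   ∎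

∑-const : ∀ (xs : List A) c → ∑[ x ∈ xs ] c ≡ length xs * c
∑-const []       c = refl
∑-const (x ∷ xs) c = cong (c +_) (∑-const xs c)

∑-comm : ∀ (xs : List A) (ys : List B) (f : A → B → ℕ) →
         ∑[ x ∈ xs ] ∑[ y ∈ ys ] f x y ≡ ∑[ y ∈ ys ] ∑[ x ∈ xs ] f x y
∑-comm []       ys f = sym (trans (∑-const ys 0) (*-zeroʳ (length ys)))
∑-comm (x ∷ xs) ys f = trans (cong (∑ ys (f x) +_) (∑-comm xs ys f)) (sym (∑-distrib-+ ys (f x) _))

∑-zero : ∀ (xs : List A) → ∑[ x ∈ xs ] 0 ≡ 0
∑-zero xs = trans (∑-const xs 0) (*-zeroʳ (length xs))

∑-upTo-suc : ∀ n (f : ℕ → ℕ) → ∑ (upTo (suc n)) f ≡ f 0 + ∑[ k ∈ upTo n ] f (suc k)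
∑-upTo-suc n f = cong (f 0 +_) (begin
  ∑ (applyUpTo suc n) f    ≡⟨ cong (λ ks → ∑ ks f) (map-upTo suc n) ⟨
  ∑ (map suc (upTo n)) f   ≡⟨ ∑-map suc (upTo n) f ⟩
  ∑ (upTo n) (f ∘ suc)     ∎)

∑-upTo-∷ʳ : ∀ n (f : ℕ → ℕ) → ∑ (upTo (suc n)) f ≡ ∑ (upTo n) f + f n
∑-upTo-∷ʳ n f = begin
  ∑ (upTo (suc n)) f             ≡⟨ cong (λ ks → ∑ ks f) (upTo-∷ʳ n) ⟨
  ∑ (upTo n ∷ʳ n) f              ≡⟨ ∑-++ (upTo n) (n ∷ []) f ⟩
  ∑ (upTo n) f + (f n + 0)       ≡⟨ cong (∑ (upTo n) f +_) (+-identityʳ (f n)) ⟩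
  ∑ (upTo n) f + f n             ∎

∑-upTo-periodic : ∀ n (a : ℕ → ℕ) → (∀ k → a (k + n) ≡ a k) →
                  ∀ i → ∑[ k ∈ upTo n ] a (k + i) ≡ ∑ (upTo n) a
∑-upTo-periodic n a period zero    = ∑-cong (upTo n) (λ {k} _ → cong a (+-identityʳ k))
∑-upTo-periodic n a period (suc i) = begin
  ∑[ k ∈ upTo n ] a (k + suc i)   ≡⟨ ∑-cong (upTo n) (λ {k} _ → cong a (+-suc k i)) ⟩
  ∑[ k ∈ upTo n ] b (suc k)       ≡⟨ +-cancelˡ-≡ (b 0) _ _ rotate ⟩
  ∑ (upTo n) b                    ≡⟨ ∑-upTo-periodic n a period i ⟩
  ∑ (upTo n) a                    ∎
  where
  b : ℕ → ℕ
  b k = a (k + i)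
  rotate : b 0 + ∑[ k ∈ upTo n ] b (suc k) ≡ b 0 + ∑ (upTo n) b
  rotate = begin
    b 0 + ∑[ k ∈ upTo n ] b (suc k)   ≡⟨ ∑-upTo-suc n b ⟨
    ∑ (upTo (suc n)) b                ≡⟨ ∑-upTo-∷ʳ n b ⟩
    ∑ (upTo n) b + b n                ≡⟨ cong (∑ (upTo n) b +_) (trans (cong a (+-comm n i)) (period i)) ⟩
    ∑ (upTo n) b + b 0                ≡⟨ +-comm _ (b 0) ⟩
    b 0 + ∑ (upTo n) b                ∎

∑-upTo-2-periodic : ∀ h (c : ℕ → ℕ) → (∀ k → c (suc (suc k)) ≡ c k) → ∑ (upTo (h * 2)) c ≡ h * (c 0 + c 1)
∑-upTo-2-periodic zero     c period = refl
∑-upTo-2-periodic (suc h) c period = begin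
  ∑ (upTo (suc (suc (h * 2)))) c                            ≡⟨ ∑-upTo-suc (suc (h * 2)) c ⟩
  c 0 + ∑[ k ∈ upTo (suc (h * 2)) ] c (suc k)               ≡⟨ cong (c 0 +_) (∑-upTo-suc (h * 2) (c ∘ suc)) ⟩
  c 0 + (c 1 + ∑[ k ∈ upTo (h * 2) ] c (suc (suc k)))       ≡⟨ +-assoc (c 0) (c 1) _ ⟨
  c 0 + c 1 + ∑[ k ∈ upTo (h * 2) ] c (suc (suc k))
    ≡⟨ cong (c 0 + c 1 +_) (∑-cong (upTo (h * 2)) (λ {k} _ → period k)) ⟩
  c 0 + c 1 + ∑ (upTo (h * 2)) c                            ≡⟨ cong (c 0 + c 1 +_) (∑-upTo-2-periodic h c period) ⟩
  c 0 + c 1 + h * (c 0 + c 1)                               ∎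

∑-upTo-δ : ∀ {m b} (g : ℕ → ℕ) → b < m → ∑[ a ∈ upTo m ] (𝟙 (a ≡ᵇ b) * g a) ≡ g b
∑-upTo-δ {suc m} {zero}  g _ = begin
  ∑[ a ∈ upTo (suc m) ] (𝟙 (a ≡ᵇ 0) * g a)   ≡⟨ ∑-upTo-suc m _ ⟩
  (g 0 + 0) + ∑[ a ∈ upTo m ] 0           ≡⟨ cong₂ _+_ (+-identityʳ (g 0)) (∑-zero (upTo m)) ⟩
  g 0 + 0                                 ≡⟨ +-identityʳ (g 0) ⟩
  g 0                                     ∎
∑-upTo-δ {suc m} {suc b} g (s≤s b<m) =
  trans (∑-upTo-suc m (λ a → 𝟙 (a ≡ᵇ suc b) * g a)) (∑-upTo-δ (g ∘ suc) b<m)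

-- Only symmetry and transitivity are assumed: `sameOrbit [] []` is false, so the orbit relation
-- is reflexive on nonempty words only.
module ClassSums {A : Set} (_≈_ : A → A → Bool)
  (≈-sym : ∀ {x y} → x ≈ y ≡ true → y ≈ x ≡ true)
  (≈-trans : ∀ {x y z} → x ≈ y ≡ true → y ≈ z ≡ true → x ≈ z ≡ true) where

  classSum : (A → ℕ) → List A → List A → ℕ
  classSum p seen []       = 0
  classSum p seen (x ∷ xs) = if any (x ≈_) seen then classSum p seen xs else p x + classSum p (x ∷ seen) xs

  classSum-+ : ∀ (p q : A → ℕ) seen xs → classSum (λ x → p x + q x) seen xs ≡ classSum p seen xs + classSum q seen xs
  classSum-+ p q seen []       = refl
  classSum-+ p q seen (x ∷ xs) with any (x ≈_) seen
  ... | true  = classSum-+ p q seen xs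
  ... | false = trans (cong (p x + q x +_) (classSum-+ p q (x ∷ seen) xs)) (interchange (p x) (q x) _ _)

  classSum-cong : ∀ {p q : A → ℕ} seen xs → (∀ {x} → x ∈ xs → p x ≡ q x) → classSum p seen xs ≡ classSum q seen xs
  classSum-cong seen []       p≗q = refl
  classSum-cong seen (x ∷ xs) p≗q with any (x ≈_) seen
  ... | true  = classSum-cong seen xs (p≗q ∘ there)
  ... | false = cong₂ _+_ (p≗q (here refl)) (classSum-cong (x ∷ seen) xs (p≗q ∘ there))

  ≉-sym : ∀ {x y} → x ≈ y ≡ false → y ≈ x ≡ false
  ≉-sym {x} {y} x≉y with y ≈ x in y≈x
  ... | false = refl
  ... | true  = trans (sym (≈-sym {y} {x} y≈x)) x≉y

  ≈-respˡ : ∀ {x y} s → x ≈ y ≡ true → (x ≈ s) ≡ (y ≈ s)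
  ≈-respˡ {x} {y} s x≈y = ⇔→≡ (mk⇔ (≈-trans {y} {x} {s} (≈-sym {x} {y} x≈y)) (≈-trans {x} {y} {s} x≈y))

  ≈-respʳ : ∀ {x y} s → x ≈ y ≡ true → (s ≈ x) ≡ (s ≈ y)
  ≈-respʳ {x} {y} s x≈y =
    ⇔→≡ (mk⇔ (λ s≈x → ≈-trans {s} {x} {y} s≈x x≈y) (λ s≈y → ≈-trans {s} {y} {x} s≈y (≈-sym {x} {y} x≈y)))

  seen-resp : ∀ {x y} seen → x ≈ y ≡ true → any (x ≈_) seen ≡ any (y ≈_) seen
  seen-resp seen x≈y = cong or (map-cong (λ s → ≈-respˡ s x≈y) seen)

  unseen-∷ : ∀ {w} seen → any (w ≈_) seen ≡ false → ∀ x →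
             𝟙 (not (any (x ≈_) seen)) ≡ 𝟙 (not (any (x ≈_) (w ∷ seen))) + 𝟙 (w ≈ x)
  unseen-∷ {w} seen w-unseen x with x ≈ w in x≈w
  ... | true  rewrite ≈-sym {x} {w} x≈w | seen-resp seen x≈w | w-unseen = refl
  ... | false rewrite ≉-sym {x} {w} x≈w = sym (+-identityʳ _)

  drop-unrelated : ∀ {x w} xs (f : A → ℕ) → x ≈ w ≡ false →
                   ∑[ y ∈ w ∷ xs ] (𝟙 (x ≈ y) * f y) ≡ ∑[ y ∈ xs ] (𝟙 (x ≈ y) * f y)
  drop-unrelated {x} {w} xs f x≉w = cong (λ b → 𝟙 b * f w + ∑[ y ∈ xs ] (𝟙 (x ≈ y) * f y)) x≉w

  class-mass : ∀ {n} (p f : A → ℕ) → (∀ {x y} → x ≈ y ≡ true → p x ≡ p y) → ∀ {w} xs → w ≈ w ≡ true →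
               ∑[ y ∈ w ∷ xs ] (𝟙 (w ≈ y) * f y) ≡ n →
               n * p w ≡ p w * f w + ∑[ x ∈ xs ] (𝟙 (w ≈ x) * (p x * f x))
  class-mass {n} p f p-inv {w} xs w≈w mass = begin
    n * p w                                                 ≡⟨ *-comm n (p w) ⟩
    p w * n                                                 ≡⟨ cong (p w *_) mass ⟨
    p w * (𝟙 (w ≈ w) * f w + ∑[ x ∈ xs ] (𝟙 (w ≈ x) * f x))
      ≡⟨ cong (λ b → p w * (𝟙 b * f w + ∑[ x ∈ xs ] (𝟙 (w ≈ x) * f x))) w≈w ⟩
    p w * (1 * f w + ∑[ x ∈ xs ] (𝟙 (w ≈ x) * f x))        ≡⟨ *-distribˡ-+ (p w) (1 * f w) _ ⟩
    p w * (1 * f w) + p w * ∑[ x ∈ xs ] (𝟙 (w ≈ x) * f x)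
      ≡⟨ cong₂ _+_ (cong (p w *_) (*-identityˡ (f w))) (*-distribˡ-∑ (p w) xs _) ⟩
    p w * f w + ∑[ x ∈ xs ] (p w * (𝟙 (w ≈ x) * f x))      ≡⟨ cong (p w * f w +_) (∑-cong xs (λ {x} _ → weigh x)) ⟩
    p w * f w + ∑[ x ∈ xs ] (𝟙 (w ≈ x) * (p x * f x))      ∎
    where
    weigh : ∀ x → p w * (𝟙 (w ≈ x) * f x) ≡ 𝟙 (w ≈ x) * (p x * f x)
    weigh x with w ≈ x in w≈x
    ... | true  rewrite p-inv w≈x = trans (cong (p x *_) (+-identityʳ (f x))) (sym (+-identityʳ _))
    ... | false = *-zeroʳ (p w)

  classSum-weighted : ∀ n (p f : A → ℕ) → (∀ {x y} → x ≈ y ≡ true → p x ≡ p y) → ∀ seen xs →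
    (∀ {x} → x ∈ xs → x ≈ x ≡ true) →
    (∀ {x} → x ∈ xs → any (x ≈_) seen ≡ false → ∑[ y ∈ xs ] (𝟙 (x ≈ y) * f y) ≡ n) →
    n * classSum p seen xs ≡ ∑[ x ∈ xs ] (𝟙 (not (any (x ≈_) seen)) * (p x * f x))
  classSum-weighted n p f p-inv seen []       _       _    = *-zeroʳ n
  classSum-weighted n p f p-inv seen (w ∷ xs) refl-ok mass with any (w ≈_) seen in w-seen
  ... | true  = classSum-weighted n p f p-inv seen xs (refl-ok ∘ there) mass-xs
    where
    mass-xs : ∀ {x} → x ∈ xs → any (x ≈_) seen ≡ false → ∑[ y ∈ xs ] (𝟙 (x ≈ y) * f y) ≡ n
    mass-xs {x} x∈ x-unseen = trans (sym (drop-unrelated xs f x≉w)) (mass {x} (there x∈) x-unseen)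
      where
      x≉w : x ≈ w ≡ false
      x≉w with x ≈ w in x≈w
      ... | false = refl
      ... | true  = trans (sym w-seen) (trans (sym (seen-resp seen x≈w)) x-unseen)
  ... | false = begin
    n * (p w + classSum p (w ∷ seen) xs)
      ≡⟨ *-distribˡ-+ n (p w) _ ⟩
    n * p w + n * classSum p (w ∷ seen) xs
      ≡⟨ cong₂ _+_ (class-mass p f p-inv xs (refl-ok (here refl)) (mass (here refl) w-seen))
                   (classSum-weighted n p f p-inv (w ∷ seen) xs (refl-ok ∘ there) mass-xs) ⟩
    p w * f w + ∑[ x ∈ xs ] (𝟙 (w ≈ x) * (p x * f x)) + ∑[ x ∈ xs ] (U′ x * (p x * f x))
      ≡⟨ +-assoc (p w * f w) _ _ ⟩
    p w * f w + (∑[ x ∈ xs ] (𝟙 (w ≈ x) * (p x * f x)) + ∑[ x ∈ xs ] (U′ x * (p x * f x)))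
      ≡⟨ cong (p w * f w +_) (+-comm (∑[ x ∈ xs ] (𝟙 (w ≈ x) * (p x * f x))) _) ⟩
    p w * f w + (∑[ x ∈ xs ] (U′ x * (p x * f x)) + ∑[ x ∈ xs ] (𝟙 (w ≈ x) * (p x * f x)))
      ≡⟨ cong (p w * f w +_) (∑-distrib-+ xs _ _) ⟨
    p w * f w + ∑[ x ∈ xs ] (U′ x * (p x * f x) + 𝟙 (w ≈ x) * (p x * f x))
      ≡⟨ cong₂ _+_ (*-identityˡ (p w * f w)) (∑-cong xs (λ {x} _ → merge x)) ⟨
    1 * (p w * f w) + ∑[ x ∈ xs ] (U x * (p x * f x))
      ∎
    where
    U U′ : A → ℕ
    U  x = 𝟙 (not (any (x ≈_) seen))
    U′ x = 𝟙 (not (any (x ≈_) (w ∷ seen)))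
    merge : ∀ x → U x * (p x * f x) ≡ U′ x * (p x * f x) + 𝟙 (w ≈ x) * (p x * f x)
    merge x = trans (cong (_* (p x * f x)) (unseen-∷ seen w-seen x)) (*-distribʳ-+ (p x * f x) (U′ x) _)
    mass-xs : ∀ {x} → x ∈ xs → any (x ≈_) (w ∷ seen) ≡ false → ∑[ y ∈ xs ] (𝟙 (x ≈ y) * f y) ≡ n
    mass-xs {x} x∈ x-unseen =
      trans (sym (drop-unrelated xs f (∨-conicalˡ _ _ x-unseen))) (mass {x} (there x∈) (∨-conicalʳ _ _ x-unseen))

  firstIndex : List A → A → ℕ
  firstIndex []       y = 0
  firstIndex (x ∷ xs) y = if x ≈ y then 0 else suc (firstIndex xs y)

  firstIndex-resp : ∀ xs {x y} → x ≈ y ≡ true → firstIndex xs x ≡ firstIndex xs y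
  firstIndex-resp []       x≈y = refl
  firstIndex-resp (s ∷ xs) x≈y = cong₂ (λ b i → if b then 0 else suc i) (≈-respʳ s x≈y) (firstIndex-resp xs x≈y)

  firstIndex-injective : ∀ {xs x y} → x ∈ xs → x ≈ x ≡ true → firstIndex xs x ≡ firstIndex xs y → x ≈ y ≡ true
  firstIndex-injective {s ∷ xs} {x} {y} x∈ x≈x eq with s ≈ x in s≈x | s ≈ y in s≈y
  ... | true  | true  = ≈-trans {x} {s} {y} (≈-sym {s} {x} s≈x) s≈y
  ... | true  | false = contradiction eq λ ()
  ... | false | true  = contradiction eq λ ()
  ... | false | false with x∈
  ...   | here refl = contradiction (trans (sym s≈x) x≈x) λ ()
  ...   | there x∈′ = firstIndex-injective x∈′ x≈x (suc-injective eq)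

𝟙-∧ : ∀ a b → 𝟙 (a ∧ b) ≡ 𝟙 a * 𝟙 b
𝟙-∧ true  b = sym (*-identityˡ (𝟙 b))
𝟙-∧ false b = refl

trichotomy-𝟙 : ∀ a b → 𝟙 (a ≡ᵇ b) + 𝟙 (a <ᵇ b) + 𝟙 (b <ᵇ a) ≡ 1
trichotomy-𝟙 zero    zero    = refl
trichotomy-𝟙 zero    (suc b) = refl
trichotomy-𝟙 (suc a) zero    = refl
trichotomy-𝟙 (suc a) (suc b) = trichotomy-𝟙 a b

==-sound : ∀ {u v} → (u == v) ≡ true → u ≡ v
==-sound u==v = toWitness (Equivalence.from T-≡ u==v)

==-complete : ∀ {u v} → u ≡ v → (u == v) ≡ true
==-complete u≡v = Equivalence.to T-≡ (fromWitness u≡v)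

==-false : ∀ {u v} → u ≢ v → (u == v) ≡ false
==-false u≢v = Equivalence.to T-not-≡ (fromWitnessFalse u≢v)

==-⇔ : ∀ {u v u′ v′} → (u ≡ v → u′ ≡ v′) → (u′ ≡ v′ → u ≡ v) → (u == v) ≡ (u′ == v′)
==-⇔ {u} {v} {u′} {v′} to from = begin
  isYes (≡-dec _≟_ u v)      ≡⟨ isYes≗does (≡-dec _≟_ u v) ⟩
  does (≡-dec _≟_ u v)       ≡⟨ does-⇔ (mk⇔ to from) (≡-dec _≟_ u v) (≡-dec _≟_ u′ v′) ⟩
  does (≡-dec _≟_ u′ v′)     ≡⟨ isYes≗does (≡-dec _≟_ u′ v′) ⟨
  isYes (≡-dec _≟_ u′ v′)    ∎

==-sym : ∀ u v → (u == v) ≡ (v == u)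
==-sym u v = ==-⇔ sym sym

==-injective : ∀ (f : Word → Word) → (∀ {u v} → f u ≡ f v → u ≡ v) → ∀ u v → (f u == f v) ≡ (u == v)
==-injective f f-inj u v = ==-⇔ f-inj (cong f)

==-∷ : ∀ a b w v → ((a ∷ w) == (b ∷ v)) ≡ (a ≡ᵇ b) ∧ (w == v)
==-∷ a b w v = by-cases (a ≟ b)
  where
  -- a `with` on `a ≟ b` would also abstract it inside the unfolded `==`
  by-cases : Dec (a ≡ b) → ((a ∷ w) == (b ∷ v)) ≡ (a ≡ᵇ b) ∧ (w == v)
  by-cases (yes refl) =
    trans (==-⇔ (proj₂ ∘ ∷-injective) (cong (a ∷_))) (cong (_∧ (w == v)) (sym (dec-true (a ≟ a) refl)))
  by-cases (no a≢b) =
    trans (==-false (a≢b ∘ proj₁ ∘ ∷-injective)) (cong (_∧ (w == v)) (sym (dec-false (a ≟ b) a≢b)))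

shiftⁿ-+ : ∀ i j w → shiftⁿ (i + j) w ≡ shiftⁿ i (shiftⁿ j w)
shiftⁿ-+ zero    j w = refl
shiftⁿ-+ (suc i) j w = cong shift (shiftⁿ-+ i j w)

shiftⁿ-comm : ∀ i j w → shiftⁿ i (shiftⁿ j w) ≡ shiftⁿ j (shiftⁿ i w)
shiftⁿ-comm i j w = begin
  shiftⁿ i (shiftⁿ j w)   ≡⟨ shiftⁿ-+ i j w ⟨
  shiftⁿ (i + j) w        ≡⟨ cong (λ k → shiftⁿ k w) (+-comm i j) ⟩
  shiftⁿ (j + i) w        ≡⟨ shiftⁿ-+ j i w ⟩
  shiftⁿ j (shiftⁿ i w)   ∎

shiftⁿ-suc : ∀ k w → shiftⁿ (suc k) w ≡ shiftⁿ k (shift w)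
shiftⁿ-suc k w = shiftⁿ-comm 1 k w

shiftⁿ-length-++ : ∀ xs ys → shiftⁿ (length xs) (xs ++ ys) ≡ ys ++ xs
shiftⁿ-length-++ []       ys = sym (++-identityʳ ys)
shiftⁿ-length-++ (x ∷ xs) ys = begin
  shiftⁿ (suc (length xs)) (x ∷ xs ++ ys)      ≡⟨ shiftⁿ-suc (length xs) (x ∷ xs ++ ys) ⟩
  shiftⁿ (length xs) ((xs ++ ys) ++ x ∷ [])    ≡⟨ cong (shiftⁿ (length xs)) (++-assoc xs ys (x ∷ [])) ⟩
  shiftⁿ (length xs) (xs ++ ys ++ x ∷ [])      ≡⟨ shiftⁿ-length-++ xs (ys ++ x ∷ []) ⟩
  (ys ++ x ∷ []) ++ xs                         ≡⟨ ++-assoc ys (x ∷ []) xs ⟩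
  ys ++ x ∷ xs                                 ∎

shiftⁿ-length : ∀ w → shiftⁿ (length w) w ≡ w
shiftⁿ-length w = trans (cong (shiftⁿ (length w)) (sym (++-identityʳ w))) (shiftⁿ-length-++ w [])

shiftⁿ-length-≡ : ∀ {n w} → length w ≡ n → shiftⁿ n w ≡ w
shiftⁿ-length-≡ {w = w} refl = shiftⁿ-length w

shiftⁿ-*-length : ∀ q w → shiftⁿ (q * length w) w ≡ w
shiftⁿ-*-length zero    w = refl
shiftⁿ-*-length (suc q) w = begin
  shiftⁿ (length w + q * length w) w            ≡⟨ shiftⁿ-+ (length w) (q * length w) w ⟩
  shiftⁿ (length w) (shiftⁿ (q * length w) w)   ≡⟨ cong (shiftⁿ (length w)) (shiftⁿ-*-length q w) ⟩
  shiftⁿ (length w) w                           ≡⟨ shiftⁿ-length w ⟩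
  w                                             ∎

shiftⁿ-% : ∀ k w .{{_ : NonZero (length w)}} → shiftⁿ (k % length w) w ≡ shiftⁿ k w
shiftⁿ-% k w = begin
  shiftⁿ (k % n) w                           ≡⟨ cong (shiftⁿ (k % n)) (shiftⁿ-*-length (k / n) w) ⟨
  shiftⁿ (k % n) (shiftⁿ ((k / n) * n) w)    ≡⟨ shiftⁿ-+ (k % n) ((k / n) * n) w ⟨
  shiftⁿ (k % n + (k / n) * n) w             ≡⟨ cong (λ i → shiftⁿ i w) (m≡m%n+[m/n]*n k n) ⟨
  shiftⁿ k w                                 ∎
  where n = length w

length-shift : ∀ w → length (shift w) ≡ length w
length-shift []       = refl
length-shift (x ∷ xs) = trans (length-++ xs) (+-comm (length xs) 1)

length-shiftⁿ : ∀ k w → length (shiftⁿ k w) ≡ length w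
length-shiftⁿ zero    w = refl
length-shiftⁿ (suc k) w = trans (length-shift (shiftⁿ k w)) (length-shiftⁿ k w)

shift-injective : ∀ {u v} → shift u ≡ shift v → u ≡ v
shift-injective {[]}     {[]}     _  = refl
shift-injective {[]}     {y ∷ ys} eq with () ← ++-conicalʳ ys (y ∷ []) (sym eq)
shift-injective {x ∷ xs} {[]}     eq with () ← ++-conicalʳ xs (x ∷ []) eq
shift-injective {x ∷ xs} {y ∷ ys} eq with xs≡ys , x≡y ← ∷ʳ-injective xs ys eq = cong₂ _∷_ x≡y xs≡ys

shiftⁿ-injective : ∀ k {u v} → shiftⁿ k u ≡ shiftⁿ k v → u ≡ v
shiftⁿ-injective zero    eq = eq
shiftⁿ-injective (suc k) eq = shiftⁿ-injective k (shift-injective eq)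

shift-reverse-shift : ∀ w → shift (reverse (shift w)) ≡ reverse w
shift-reverse-shift []       = refl
shift-reverse-shift (x ∷ xs) = begin
  shift (reverse (xs ++ x ∷ []))   ≡⟨ cong shift (reverse-++ xs (x ∷ [])) ⟩
  reverse xs ++ x ∷ []             ≡⟨ unfold-reverse x xs ⟨
  reverse (x ∷ xs)                 ∎

shiftⁿ-reverse-shiftⁿ : ∀ k w → shiftⁿ k (reverse (shiftⁿ k w)) ≡ reverse w
shiftⁿ-reverse-shiftⁿ zero    w = refl
shiftⁿ-reverse-shiftⁿ (suc k) w = begin
  shiftⁿ (suc k) (reverse (shift (shiftⁿ k w)))    ≡⟨ shiftⁿ-suc k _ ⟩
  shiftⁿ k (shift (reverse (shift (shiftⁿ k w))))  ≡⟨ cong (shiftⁿ k) (shift-reverse-shift (shiftⁿ k w)) ⟩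
  shiftⁿ k (reverse (shiftⁿ k w))                  ≡⟨ shiftⁿ-reverse-shiftⁿ k w ⟩
  reverse w                                        ∎

_∼_ : Word → Word → Set
u ∼ v = sameOrbit u v ≡ true

∼-sound : ∀ {u v} → u ∼ v → ∃[ k ] k < length u × shiftⁿ k u ≡ v
∼-sound {u} {v} u∼v
  with k , k∈ , hit ← find (any⁻ (λ k → shiftⁿ k u == v) (upTo (length u)) (Equivalence.from T-≡ u∼v))
  = k , ∈-upTo⁻ k∈ , toWitness hit

∼-intro : ∀ k {u v} .{{_ : NonZero (length u)}} → shiftⁿ k u ≡ v → u ∼ v
∼-intro k {u} {v} σᵏu≡v = Equivalence.to T-≡ (any⁺ (λ k → shiftⁿ k u == v)
  (lose (∈-upTo⁺ (m%n<n k (length u))) (fromWitness (trans (shiftⁿ-% k u) σᵏu≡v))))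

∼-nonZero : ∀ {u v} → u ∼ v → NonZero (length u)
∼-nonZero {u} {v} u∼v with k , k<n , _ ← ∼-sound {u} {v} u∼v = >-nonZero (m<n⇒0<n k<n)

∼-refl : ∀ {x xs} → (x ∷ xs) ∼ (x ∷ xs)
∼-refl {x} {xs} = ∼-intro 0 {x ∷ xs} refl

∼-sym : ∀ {u v} → u ∼ v → v ∼ u
∼-sym {u} {v} u∼v with k , k<n , refl ← ∼-sound {u} {v} u∼v = ∼-intro (length u ∸ k) {{nonZero}} (begin
  shiftⁿ (length u ∸ k) (shiftⁿ k u)   ≡⟨ shiftⁿ-+ (length u ∸ k) k u ⟨
  shiftⁿ (length u ∸ k + k) u          ≡⟨ cong (λ i → shiftⁿ i u) (m∸n+n≡m (<⇒≤ k<n)) ⟩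
  shiftⁿ (length u) u                  ≡⟨ shiftⁿ-length u ⟩
  u                                    ∎)
  where
  nonZero : NonZero (length (shiftⁿ k u))
  nonZero = >-nonZero (subst (0 <_) (sym (length-shiftⁿ k u)) (m<n⇒0<n k<n))

∼-trans : ∀ {u v w} → u ∼ v → v ∼ w → u ∼ w
∼-trans {u} {v} {w} u∼v v∼w with k , _ , refl ← ∼-sound {u} {v} u∼v | j , _ , refl ← ∼-sound {v} {w} v∼w =
  ∼-intro (j + k) {{∼-nonZero {u} {v} u∼v}} (shiftⁿ-+ j k u)

∼-reverse : ∀ {u v} → u ∼ v → reverse u ∼ reverse v
∼-reverse {u} {v} u∼v with k , k<n , refl ← ∼-sound {u} {v} u∼v =
  ∼-sym {reverse v} (∼-intro k {{nonZero}} (shiftⁿ-reverse-shiftⁿ k u))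
  where
  nonZero : NonZero (length (reverse (shiftⁿ k u)))
  nonZero = >-nonZero (subst (0 <_) (sym (trans (length-reverse (shiftⁿ k u)) (length-shiftⁿ k u))) (m<n⇒0<n k<n))

open ClassSums sameOrbit (λ {u} {v} → ∼-sym {u} {v}) (λ {u} {v} {w} → ∼-trans {u} {v} {w})

-- The worker `go` of `countOrbits` is local to its `where` block; generalising the arguments
-- it is applied to lets unification recover it as `countOrbitsFrom`.
mutual
  countOrbitsFrom : List Word → List Word → List Word → ℕ
  countOrbitsFrom = _

  countOrbits-∷ : ∀ w ws → countOrbits (w ∷ ws) ≡ suc (countOrbitsFrom (w ∷ ws) [ w ] ws)
  countOrbits-∷ w ws with w List.∷ ws | [ w ]
  ... | _ | _ = refl

countOrbitsFrom≡classSum : ∀ ws₀ seen ws → countOrbitsFrom ws₀ seen ws ≡ classSum (λ _ → 1) seen ws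
countOrbitsFrom≡classSum ws₀ seen []       = refl
countOrbitsFrom≡classSum ws₀ seen (w ∷ ws) with any (sameOrbit w) seen
... | true  = countOrbitsFrom≡classSum ws₀ seen ws
... | false = cong suc (countOrbitsFrom≡classSum ws₀ (w ∷ seen) ws)

countOrbits≡classSum : ∀ ws → countOrbits ws ≡ classSum (λ _ → 1) [] ws
countOrbits≡classSum []       = refl
countOrbits≡classSum (w ∷ ws) = trans (countOrbits-∷ w ws) (cong suc (countOrbitsFrom≡classSum (w ∷ ws) [ w ] ws))

IsWord : ℕ → ℕ → Word → Set
IsWord n m w = length w ≡ n × All (_< m) w

∈-words⁻ : ∀ {n m w} → w ∈ words n m → IsWord n m w
∈-words⁻ {zero}      (here refl) = refl , []
∈-words⁻ {suc n} {m} w∈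
  with a , a∈ , w∈′ ← find (∈-concatMap⁻ (λ a → map (a ∷_) (words n m)) {xs = upTo m} w∈)
  with v , v∈ , refl ← ∈-map⁻ (a ∷_) w∈′
  with |v|≡n , v<m ← ∈-words⁻ v∈
  = cong suc |v|≡n , ∈-upTo⁻ a∈ ∷ v<m

∈-words⁺ : ∀ {n m v} → IsWord n m v → v ∈ words n m
∈-words⁺ {zero}  {m} {[]}    _                  = here refl
∈-words⁺ {suc n} {m} {b ∷ v} (|bv|≡ , b<m ∷ v<m) =
  ∈-concatMap⁺ (λ a → map (a ∷_) (words n m))
    (lose (∈-upTo⁺ b<m) (∈-map⁺ (b ∷_) (∈-words⁺ (suc-injective |bv|≡ , v<m))))

isWord-shift : ∀ {n m w} → IsWord n m w → IsWord n m (shift w)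
isWord-shift {w = []}     w-ok             = w-ok
isWord-shift {w = x ∷ xs} (|w|≡n , x<m ∷ xs<m) = trans (length-shift (x ∷ xs)) |w|≡n , ∷ʳ⁺ xs<m x<m

isWord-shiftⁿ : ∀ {n m} k {w} → IsWord n m w → IsWord n m (shiftⁿ k w)
isWord-shiftⁿ zero    w-ok = w-ok
isWord-shiftⁿ (suc k) w-ok = isWord-shift (isWord-shiftⁿ k w-ok)

isWord-reverse : ∀ {n m w} → IsWord n m w → IsWord n m (reverse w)
isWord-reverse {w = w} (|w|≡n , w<m) = trans (length-reverse w) |w|≡n , tabulate (lookupᴬ w<m ∘ reverse⁻)

isWord-drop : ∀ k {l m w} → IsWord (k + l) m w → IsWord l m (drop k w)
isWord-drop k {l} {w = w} (|w|≡ , w<m) =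
  trans (length-drop k w) (trans (cong (_∸ k) |w|≡) (m+n∸m≡n k l)) , drop⁺ k w<m

isWord-++ : ∀ {k l m u v} → IsWord k m u → IsWord l m v → IsWord (k + l) m (u ++ v)
isWord-++ {u = u} (|u|≡ , u<m) (|v|≡ , v<m) = trans (length-++ u) (cong₂ _+_ |u|≡ |v|≡) , ++⁺ u<m v<m

isWord-∼-refl : ∀ {n m w} .{{_ : NonZero n}} → IsWord n m w → w ∼ w
isWord-∼-refl {suc n} {w = x ∷ xs} _ = ∼-refl {x} {xs}
isWord-∼-refl {suc n} {w = []}     (() , _)

∑-words-suc : ∀ n m (g : Word → ℕ) → ∑ (words (suc n) m) g ≡ ∑[ a ∈ upTo m ] ∑[ w ∈ words n m ] g (a ∷ w)
∑-words-suc n m g = trans (∑-concatMap (λ a → map (a ∷_) (words n m)) (upTo m) g)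
                          (∑-cong (upTo m) (λ {a} _ → ∑-map (a ∷_) (words n m) g))

∑-words-1 : ∀ n m → ∑[ w ∈ words n m ] 1 ≡ m ^ n
∑-words-1 zero    m = refl
∑-words-1 (suc n) m = begin
  ∑[ w ∈ words (suc n) m ] 1                   ≡⟨ ∑-words-suc n m (λ _ → 1) ⟩
  ∑[ a ∈ upTo m ] ∑[ w ∈ words n m ] 1         ≡⟨ ∑-cong (upTo m) (λ _ → ∑-words-1 n m) ⟩
  ∑[ a ∈ upTo m ] (m ^ n)                      ≡⟨ ∑-const (upTo m) (m ^ n) ⟩
  length (upTo m) * m ^ n                      ≡⟨ cong (_* m ^ n) (length-upTo m) ⟩
  m * m ^ n                                    ∎

∑-words-δ : ∀ {n m v} → IsWord n m v → ∀ (g : Word → ℕ) → ∑[ w ∈ words n m ] (𝟙 (w == v) * g w) ≡ g v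
∑-words-δ {zero}      {v = []}    _                        g = trans (+-identityʳ _) (*-identityˡ (g []))
∑-words-δ {suc n} {m} {v = b ∷ v} (|bv|≡ , b<m ∷ v<m) g = begin
  ∑[ w ∈ words (suc n) m ] (𝟙 (w == (b ∷ v)) * g w)
    ≡⟨ ∑-words-suc n m _ ⟩
  ∑[ a ∈ upTo m ] ∑[ w ∈ words n m ] (𝟙 ((a ∷ w) == (b ∷ v)) * g (a ∷ w))
    ≡⟨ ∑-cong (upTo m) (λ {a} _ → ∑-cong (words n m) (λ {w} _ → split-δ a w)) ⟩
  ∑[ a ∈ upTo m ] ∑[ w ∈ words n m ] (𝟙 (a ≡ᵇ b) * (𝟙 (w == v) * g (a ∷ w)))
    ≡⟨ ∑-cong (upTo m) (λ {a} _ → *-distribˡ-∑ (𝟙 (a ≡ᵇ b)) (words n m) _) ⟨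
  ∑[ a ∈ upTo m ] (𝟙 (a ≡ᵇ b) * ∑[ w ∈ words n m ] (𝟙 (w == v) * g (a ∷ w)))
    ≡⟨ ∑-cong (upTo m) (λ {a} _ → cong (𝟙 (a ≡ᵇ b) *_) (∑-words-δ (suc-injective |bv|≡ , v<m) (g ∘ (a ∷_)))) ⟩
  ∑[ a ∈ upTo m ] (𝟙 (a ≡ᵇ b) * g (a ∷ v))
    ≡⟨ ∑-upTo-δ (λ a → g (a ∷ v)) b<m ⟩
  g (b ∷ v) ∎
  where
  split-δ : ∀ a w → 𝟙 ((a ∷ w) == (b ∷ v)) * g (a ∷ w) ≡ 𝟙 (a ≡ᵇ b) * (𝟙 (w == v) * g (a ∷ w))
  split-δ a w = begin
    𝟙 ((a ∷ w) == (b ∷ v)) * g (a ∷ w)          ≡⟨ cong (λ x → 𝟙 x * g (a ∷ w)) (==-∷ a b w v) ⟩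
    𝟙 ((a ≡ᵇ b) ∧ (w == v)) * g (a ∷ w)         ≡⟨ cong (_* g (a ∷ w)) (𝟙-∧ (a ≡ᵇ b) (w == v)) ⟩
    𝟙 (a ≡ᵇ b) * 𝟙 (w == v) * g (a ∷ w)         ≡⟨ *-assoc (𝟙 (a ≡ᵇ b)) _ _ ⟩
    𝟙 (a ≡ᵇ b) * (𝟙 (w == v) * g (a ∷ w))       ∎

∑-words-pushforward : ∀ {k L m} (F : Word → Word) → (∀ {v} → IsWord k m v → IsWord L m (F v)) →
  ∀ (g : Word → ℕ) →
  ∑[ v ∈ words k m ] g (F v) ≡ ∑[ w ∈ words L m ] (∑[ v ∈ words k m ] 𝟙 (w == F v) * g w)
∑-words-pushforward {k} {L} {m} F F-ok g = begin
  ∑[ v ∈ words k m ] g (F v)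
    ≡⟨ ∑-cong (words k m) (λ v∈ → ∑-words-δ (F-ok (∈-words⁻ v∈)) g) ⟨
  ∑[ v ∈ words k m ] ∑[ w ∈ words L m ] (𝟙 (w == F v) * g w)
    ≡⟨ ∑-comm (words k m) (words L m) (λ v w → 𝟙 (w == F v) * g w) ⟩
  ∑[ w ∈ words L m ] ∑[ v ∈ words k m ] (𝟙 (w == F v) * g w)
    ≡⟨ ∑-cong (words L m) (λ {w} _ → *-distribʳ-∑ (g w) (words k m) (λ v → 𝟙 (w == F v))) ⟨
  ∑[ w ∈ words L m ] (∑[ v ∈ words k m ] 𝟙 (w == F v) * g w) ∎

fiber≡1 : ∀ {k m w u} (F : Word → Word) → IsWord k m u → w ≡ F u → (∀ {v} → IsWord k m v → w ≡ F v → v ≡ u) →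
          ∑[ v ∈ words k m ] 𝟙 (w == F v) ≡ 1
fiber≡1 {k} {m} {w} {u} F u-ok w≡Fu unique = begin
  ∑[ v ∈ words k m ] 𝟙 (w == F v)           ≡⟨ ∑-cong (words k m) (λ v∈ → to-δ (∈-words⁻ v∈)) ⟩
  ∑[ v ∈ words k m ] (𝟙 (v == u) * 1)       ≡⟨ ∑-words-δ u-ok (λ _ → 1) ⟩
  1                                         ∎
  where
  to-δ : ∀ {v} → IsWord k m v → 𝟙 (w == F v) ≡ 𝟙 (v == u) * 1
  to-δ {v} v-ok = trans (cong 𝟙 (==-⇔ (unique v-ok) (λ v≡u → trans w≡Fu (cong F (sym v≡u))))) (sym (*-identityʳ _))

fiber≡0 : ∀ {k m w} (F : Word → Word) → (∀ {v} → IsWord k m v → w ≢ F v) → ∑[ v ∈ words k m ] 𝟙 (w == F v) ≡ 0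
fiber≡0 {k} {m} F w∉im =
  trans (∑-cong (words k m) (λ v∈ → cong 𝟙 (==-false (w∉im (∈-words⁻ v∈))))) (∑-zero (words k m))

∑-words-bijection : ∀ {n m} (φ ψ : Word → Word) →
  (∀ {w} → IsWord n m w → IsWord n m (φ w)) → (∀ {w} → IsWord n m w → IsWord n m (ψ w)) →
  (∀ {w} → IsWord n m w → ψ (φ w) ≡ w) → (∀ {w} → IsWord n m w → φ (ψ w) ≡ w) →
  ∀ (g : Word → ℕ) → ∑[ w ∈ words n m ] g (φ w) ≡ ∑ (words n m) g
∑-words-bijection {n} {m} φ ψ φ-ok ψ-ok ψφ φψ g = begin
  ∑[ w ∈ words n m ] g (φ w)                                        ≡⟨ ∑-words-pushforward φ φ-ok g ⟩
  ∑[ w ∈ words n m ] (∑[ v ∈ words n m ] 𝟙 (w == φ v) * g w)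
    ≡⟨ ∑-cong (words n m) (λ w∈ → cong (_* _) (fiber (∈-words⁻ w∈))) ⟩
  ∑[ w ∈ words n m ] (1 * g w)                                       ≡⟨ ∑-cong (words n m) (λ {w} _ → *-identityˡ (g w)) ⟩
  ∑ (words n m) g                                                    ∎
  where
  fiber : ∀ {w} → IsWord n m w → ∑[ v ∈ words n m ] 𝟙 (w == φ v) ≡ 1
  fiber {w} w-ok =
    fiber≡1 φ (ψ-ok w-ok) (sym (φψ w-ok)) (λ {v} v-ok w≡φv → trans (sym (ψφ v-ok)) (cong ψ (sym w≡φv)))

∑-words-𝟙-bijection : ∀ {k L m} (p : Word → Bool) (B D : Word → Word) →
  (∀ {v} → IsWord k m v → IsWord L m (B v)) → (∀ {v} → IsWord k m v → p (B v) ≡ true) →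
  (∀ {v} → IsWord k m v → D (B v) ≡ v) →
  (∀ {w} → IsWord L m w → p w ≡ true → IsWord k m (D w)) → (∀ {w} → IsWord L m w → p w ≡ true → B (D w) ≡ w) →
  ∑[ w ∈ words L m ] 𝟙 (p w) ≡ m ^ k
∑-words-𝟙-bijection {k} {L} {m} p B D B-ok pB DB D-ok BD = begin
  ∑[ w ∈ words L m ] 𝟙 (p w)
    ≡⟨ ∑-cong (words L m) (λ w∈ → fiber (∈-words⁻ w∈)) ⟩
  ∑[ w ∈ words L m ] (∑[ v ∈ words k m ] 𝟙 (w == B v) * 1)
    ≡⟨ ∑-words-pushforward B B-ok (λ _ → 1) ⟨
  ∑[ v ∈ words k m ] 1                                               ≡⟨ ∑-words-1 k m ⟩
  m ^ k                                                              ∎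
  where
  fiber : ∀ {w} → IsWord L m w → 𝟙 (p w) ≡ ∑[ v ∈ words k m ] 𝟙 (w == B v) * 1
  fiber {w} w-ok with p w in pw
  ... | true  = sym (trans (*-identityʳ _) (fiber≡1 B (D-ok w-ok pw) (sym (BD w-ok pw))
                  (λ v-ok w≡Bv → trans (sym (DB v-ok)) (cong D (sym w≡Bv)))))
  ... | false = sym (trans (*-identityʳ _) (fiber≡0 B
                  (λ v-ok w≡Bv → contradiction (trans (sym pw) (trans (cong p w≡Bv) (pB v-ok))) λ ())))

stabSize : ℕ → Word → ℕ
stabSize n w = ∑[ k ∈ upTo n ] 𝟙 (shiftⁿ k w == w)

stabSize-shiftⁿ : ∀ n j u → stabSize n (shiftⁿ j u) ≡ stabSize n u
stabSize-shiftⁿ n j u = ∑-cong (upTo n) (λ {k} _ → cong 𝟙 (begin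
  (shiftⁿ k (shiftⁿ j u) == shiftⁿ j u)   ≡⟨ cong (_== shiftⁿ j u) (shiftⁿ-comm k j u) ⟩
  (shiftⁿ j (shiftⁿ k u) == shiftⁿ j u)   ≡⟨ ==-injective (shiftⁿ j) (shiftⁿ-injective j) (shiftⁿ k u) u ⟩
  (shiftⁿ k u == u)                       ∎))

shiftⁿ-fixes-reverse : ∀ k {u} → shiftⁿ k u ≡ u → shiftⁿ k (reverse u) ≡ reverse u
shiftⁿ-fixes-reverse k {u} σᵏu≡u = begin
  shiftⁿ k (reverse u)               ≡⟨ cong (shiftⁿ k ∘ reverse) σᵏu≡u ⟨
  shiftⁿ k (reverse (shiftⁿ k u))    ≡⟨ shiftⁿ-reverse-shiftⁿ k u ⟩
  reverse u                          ∎

stabSize-reverse : ∀ n u → stabSize n (reverse u) ≡ stabSize n u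
stabSize-reverse n u = ∑-cong (upTo n) (λ {k} _ → cong 𝟙 (==-⇔ (from-reverse k) (shiftⁿ-fixes-reverse k)))
  where
  from-reverse : ∀ k → shiftⁿ k (reverse u) ≡ reverse u → shiftⁿ k u ≡ u
  from-reverse k fixed = subst (λ v → shiftⁿ k v ≡ v) (reverse-involutive u) (shiftⁿ-fixes-reverse k fixed)

stabSize-nonZero : ∀ n .{{_ : NonZero n}} u → NonZero (stabSize n u)
stabSize-nonZero (suc n) u rewrite ==-complete {u} refl = _

orbit-multiplicity : ∀ {n u} w → length u ≡ n →
                     ∑[ j ∈ upTo n ] 𝟙 (shiftⁿ j u == w) ≡ 𝟙 (sameOrbit u w) * stabSize n u
orbit-multiplicity {u = u} w refl with sameOrbit u w in u∼w
... | false = trans (∑-cong (upTo n) (λ j∈ → cong 𝟙 (==-false (miss (∈-upTo⁻ j∈))))) (∑-zero (upTo n))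
  where
  n = length u
  miss : ∀ {j} → j < n → shiftⁿ j u ≢ w
  miss {j} j<n σʲu≡w with () ← trans (sym u∼w) (∼-intro j {u} {{>-nonZero (m<n⇒0<n j<n)}} σʲu≡w)
... | true with i , _ , refl ← ∼-sound {u} {w} u∼w = begin
  ∑[ j ∈ upTo n ] 𝟙 (shiftⁿ j u == shiftⁿ i u)          ≡⟨ ∑-upTo-periodic n hit period i ⟨
  ∑[ j ∈ upTo n ] 𝟙 (shiftⁿ (j + i) u == shiftⁿ i u)    ≡⟨ ∑-cong (upTo n) (λ {j} _ → cong 𝟙 (cancel-i j)) ⟩
  stabSize n u                                          ≡⟨ +-identityʳ (stabSize n u) ⟨
  1 * stabSize n u                                      ∎
  where
  n = length u
  hit : ℕ → ℕ
  hit j = 𝟙 (shiftⁿ j u == shiftⁿ i u)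
  period : ∀ j → hit (j + n) ≡ hit j
  period j = cong (λ v → 𝟙 (v == shiftⁿ i u)) (trans (shiftⁿ-+ j n u) (cong (shiftⁿ j) (shiftⁿ-length u)))
  cancel-i : ∀ j → (shiftⁿ (j + i) u == shiftⁿ i u) ≡ (shiftⁿ j u == u)
  cancel-i j = begin
    (shiftⁿ (j + i) u == shiftⁿ i u)          ≡⟨ cong (_== shiftⁿ i u) (trans (shiftⁿ-+ j i u) (shiftⁿ-comm j i u)) ⟩
    (shiftⁿ i (shiftⁿ j u) == shiftⁿ i u)     ≡⟨ ==-injective (shiftⁿ i) (shiftⁿ-injective i) (shiftⁿ j u) u ⟩
    (shiftⁿ j u == u)                         ∎

-- Double counting of the pairs (j, w) with σʲ u = w, weighted by stabSize n w.
orbit-stabilizer : ∀ {n m u} .{{_ : NonZero n}} → IsWord n m u →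
                   ∑[ w ∈ words n m ] (𝟙 (sameOrbit u w) * stabSize n w) ≡ n
orbit-stabilizer {n} {m} {u} u-ok@(|u|≡ , _) =
  *-cancelˡ-≡ _ _ (S u) {{stabSize-nonZero n u}} (begin
    S u * ∑[ w ∈ Ws ] (𝟙 (sameOrbit u w) * S w)         ≡⟨ *-distribˡ-∑ (S u) Ws _ ⟩
    ∑[ w ∈ Ws ] (S u * (𝟙 (sameOrbit u w) * S w))
      ≡⟨ ∑-cong Ws (λ {w} _ → regroup (S u) (𝟙 (sameOrbit u w)) (S w)) ⟩
    ∑[ w ∈ Ws ] (𝟙 (sameOrbit u w) * S u * S w)
      ≡⟨ ∑-cong Ws (λ {w} _ → cong (_* S w) (orbit-multiplicity w |u|≡)) ⟨
    ∑[ w ∈ Ws ] (∑[ j ∈ upTo n ] 𝟙 (shiftⁿ j u == w) * S w)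
      ≡⟨ ∑-cong Ws (λ {w} _ → *-distribʳ-∑ (S w) (upTo n) _) ⟩
    ∑[ w ∈ Ws ] ∑[ j ∈ upTo n ] (𝟙 (shiftⁿ j u == w) * S w)
      ≡⟨ ∑-comm Ws (upTo n) _ ⟩
    ∑[ j ∈ upTo n ] ∑[ w ∈ Ws ] (𝟙 (shiftⁿ j u == w) * S w)
      ≡⟨ ∑-cong (upTo n) (λ {j} _ → ∑-cong Ws (λ {w} _ → cong (λ b → 𝟙 b * S w) (==-sym (shiftⁿ j u) w))) ⟩
    ∑[ j ∈ upTo n ] ∑[ w ∈ Ws ] (𝟙 (w == shiftⁿ j u) * S w)
      ≡⟨ ∑-cong (upTo n) (λ {j} _ → ∑-words-δ (isWord-shiftⁿ j u-ok) S) ⟩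
    ∑[ j ∈ upTo n ] S (shiftⁿ j u)                      ≡⟨ ∑-cong (upTo n) (λ {j} _ → stabSize-shiftⁿ n j u) ⟩
    ∑[ j ∈ upTo n ] S u                                 ≡⟨ ∑-const (upTo n) (S u) ⟩
    length (upTo n) * S u                               ≡⟨ cong (_* S u) (length-upTo n) ⟩
    n * S u                                             ≡⟨ *-comm n (S u) ⟩
    S u * n                                             ∎)
  where
  Ws = words n m
  S  = stabSize n
  regroup : ∀ x y z → x * (y * z) ≡ y * x * z
  regroup x y z = trans (sym (*-assoc x y z)) (cong (_* z) (*-comm x y))

take-++ : ∀ (xs ys : List A) → take (length xs) (xs ++ ys) ≡ xs
take-++ []       ys = refl
take-++ (x ∷ xs) ys = cong (x ∷_) (take-++ xs ys)

drop-++ : ∀ (xs ys : List A) → drop (length xs) (xs ++ ys) ≡ ys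
drop-++ []       ys = refl
drop-++ (x ∷ xs) ys = drop-++ xs ys

palindrome-split : ∀ k l {w : Word} → reverse w ≡ w → length w ≡ k + l → reverse (drop l w) ++ drop k w ≡ w
palindrome-split k l {w} w-pal |w|≡ = trans (cong (_++ drop k w) (sym take-k)) (take++drop≡id k w)
  where
  |rev-drop|≡k : length (reverse (drop l w)) ≡ k
  |rev-drop|≡k = trans (length-reverse (drop l w)) (trans (length-drop l w) (trans (cong (_∸ l) |w|≡) (m+n∸n≡m k l)))
  take-k : take k w ≡ reverse (drop l w)
  take-k = begin
    take k w                                             ≡⟨ cong (take k) w-pal ⟨
    take k (reverse w)                                   ≡⟨ cong (take k ∘ reverse) (take++drop≡id l w) ⟨
    take k (reverse (take l w ++ drop l w))              ≡⟨ cong (take k) (reverse-++ (take l w) (drop l w)) ⟩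
    take k (reverse (drop l w) ++ reverse (take l w))    ≡⟨ cong (λ i → take i _) |rev-drop|≡k ⟨
    take (length (reverse (drop l w))) (reverse (drop l w) ++ reverse (take l w)) ≡⟨ take-++ (reverse (drop l w)) _ ⟩
    reverse (drop l w)                                   ∎

-- `mirror 0 v` and `mirror 1 v` are the palindromes of even and odd length whose right half is v.
mirror : ℕ → Word → Word
mirror d v = reverse (drop d v) ++ v

mirror-palindrome : ∀ {d} → d ≤ 1 → ∀ v → reverse (mirror d v) ≡ mirror d v
mirror-palindrome z≤n v = trans (reverse-++ (reverse v) v) (cong (reverse v ++_) (reverse-involutive v))
mirror-palindrome (s≤s z≤n) []      = refl
mirror-palindrome (s≤s z≤n) (a ∷ u) = begin
  reverse (reverse u ++ a ∷ u)             ≡⟨ reverse-++ (reverse u) (a ∷ u) ⟩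
  reverse (a ∷ u) ++ reverse (reverse u)   ≡⟨ cong₂ _++_ (unfold-reverse a u) (reverse-involutive u) ⟩
  (reverse u ++ a ∷ []) ++ u               ≡⟨ ++-assoc (reverse u) (a ∷ []) u ⟩
  reverse u ++ a ∷ u                       ∎

∑-palindromes : ∀ {d} k m → d ≤ 1 → ∑[ w ∈ words (k + (d + k)) m ] 𝟙 (w == reverse w) ≡ m ^ (d + k)
∑-palindromes {d} k m d≤1 = ∑-words-𝟙-bijection (λ w → w == reverse w) (mirror d) (drop k)
  mirror-ok mirror-pal drop-mirror (λ w-ok _ → isWord-drop k w-ok) mirror-drop
  where
  mirror-ok : ∀ {v} → IsWord (d + k) m v → IsWord (k + (d + k)) m (mirror d v)
  mirror-ok v-ok = isWord-++ (isWord-reverse (isWord-drop d v-ok)) v-ok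
  mirror-pal : ∀ {v} → IsWord (d + k) m v → (mirror d v == reverse (mirror d v)) ≡ true
  mirror-pal {v} _ = ==-complete (sym (mirror-palindrome d≤1 v))
  drop-mirror : ∀ {v} → IsWord (d + k) m v → drop k (mirror d v) ≡ v
  drop-mirror {v} v-ok =
    subst (λ i → drop i (mirror d v) ≡ v) (proj₁ (isWord-reverse (isWord-drop d v-ok))) (drop-++ (reverse (drop d v)) v)
  mirror-drop : ∀ {w} → IsWord (k + (d + k)) m w → (w == reverse w) ≡ true → mirror d (drop k w) ≡ w
  mirror-drop {w} (|w|≡ , _) w-pal = begin
    reverse (drop d (drop k w)) ++ drop k w   ≡⟨ cong (λ v → reverse v ++ drop k w) (drop-drop k d w) ⟩
    reverse (drop (k + d) w) ++ drop k w      ≡⟨ cong (λ i → reverse (drop i w) ++ drop k w) (+-comm k d) ⟩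
    reverse (drop (d + k) w) ++ drop k w      ≡⟨ palindrome-split k (d + k) (sym (==-sound w-pal)) |w|≡ ⟩
    w                                         ∎

mirrorCount : ℕ → ℕ → ℕ → ℕ
mirrorCount n m j = ∑[ w ∈ words n m ] 𝟙 (shiftⁿ j w == reverse w)

mirrorCount-periodic : ∀ n m j → mirrorCount (suc n) m (suc (suc j)) ≡ mirrorCount (suc n) m j
mirrorCount-periodic n m j = begin
  ∑[ w ∈ words (suc n) m ] 𝟙 (shiftⁿ (suc (suc j)) w == reverse w)
    ≡⟨ ∑-cong (words (suc n) m) (λ {w} _ → cong 𝟙 (unshift w)) ⟩
  ∑[ w ∈ words (suc n) m ] 𝟙 (shiftⁿ j (shift w) == reverse (shift w))
    ≡⟨ ∑-words-bijection shift (shiftⁿ n) isWord-shift (isWord-shiftⁿ n) shiftⁿ-shift (shiftⁿ-length-≡ ∘ proj₁) _ ⟩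
  ∑[ w ∈ words (suc n) m ] 𝟙 (shiftⁿ j w == reverse w)   ∎
  where
  unshift : ∀ w → (shiftⁿ (suc (suc j)) w == reverse w) ≡ (shiftⁿ j (shift w) == reverse (shift w))
  unshift w = begin
    (shiftⁿ (suc (suc j)) w == reverse w)
      ≡⟨ cong₂ _==_ (shiftⁿ-suc (suc j) w) (sym (shift-reverse-shift w)) ⟩
    (shift (shiftⁿ j (shift w)) == shift (reverse (shift w)))      ≡⟨ ==-injective shift shift-injective _ _ ⟩
    (shiftⁿ j (shift w) == reverse (shift w))                      ∎
  shiftⁿ-shift : ∀ {w} → IsWord (suc n) m w → shiftⁿ n (shift w) ≡ w
  shiftⁿ-shift {w} (|w|≡ , _) = trans (sym (shiftⁿ-suc n w)) (shiftⁿ-length-≡ |w|≡)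

mirrorCount-1 : ∀ n m → mirrorCount (suc n) m 1 ≡ m * ∑[ w ∈ words n m ] 𝟙 (w == reverse w)
mirrorCount-1 n m = begin
  mirrorCount (suc n) m 1                                             ≡⟨ ∑-words-suc n m _ ⟩
  ∑[ a ∈ upTo m ] ∑[ w ∈ words n m ] 𝟙 (shift (a ∷ w) == reverse (a ∷ w))
    ≡⟨ ∑-cong (upTo m) (λ {a} _ → ∑-cong (words n m) (λ {w} _ → cong 𝟙 (strip a w))) ⟩
  ∑[ a ∈ upTo m ] ∑[ w ∈ words n m ] 𝟙 (w == reverse w)              ≡⟨ ∑-const (upTo m) _ ⟩
  length (upTo m) * ∑[ w ∈ words n m ] 𝟙 (w == reverse w)
    ≡⟨ cong (_* ∑[ w ∈ words n m ] 𝟙 (w == reverse w)) (length-upTo m) ⟩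
  m * ∑[ w ∈ words n m ] 𝟙 (w == reverse w)                          ∎
  where
  strip : ∀ a w → (shift (a ∷ w) == reverse (a ∷ w)) ≡ (w == reverse w)
  strip a w =
    trans (cong ((w ++ a ∷ []) ==_) (unfold-reverse a w)) (==-injective (_∷ʳ a) (∷ʳ-injectiveˡ _ _) w (reverse w))

achiral : Word → ℕ
achiral w = 𝟙 (sameOrbit w (reverse w))

achiral-invariant : ∀ {u v} → u ∼ v → achiral u ≡ achiral v
achiral-invariant {u} {v} u∼v =
  cong 𝟙 (trans (≈-respˡ {u} {v} (reverse u) u∼v) (≈-respʳ {reverse u} {reverse v} v (∼-reverse {u} {v} u∼v)))

module _ (n m : ℕ) .{{_ : NonZero n}} where

  classSum-by-stabSize : ∀ (p : Word → ℕ) → (∀ {u v} → u ∼ v → p u ≡ p v) →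
                   n * classSum p [] (words n m) ≡ ∑[ w ∈ words n m ] (p w * stabSize n w)
  classSum-by-stabSize p p-inv = trans
    (classSum-weighted n p (stabSize n) p-inv [] (words n m)
      (isWord-∼-refl ∘ ∈-words⁻) (λ w∈ _ → orbit-stabilizer (∈-words⁻ w∈)))
    (∑-cong (words n m) (λ {w} _ → *-identityˡ (p w * stabSize n w)))

  -- An orbit is labelled by the position of its first word in `words n m`; of two mutually reverse
  -- chiral orbits, the one with the smaller label is left-handed.
  leftHanded : Word → ℕ
  leftHanded w = 𝟙 (firstIndex (words n m) w <ᵇ firstIndex (words n m) (reverse w))

  leftHanded-invariant : ∀ {u v} → u ∼ v → leftHanded u ≡ leftHanded v
  leftHanded-invariant {u} {v} u∼v =
    cong₂ (λ i j → 𝟙 (i <ᵇ j)) (firstIndex-resp (words n m) {u} {v} u∼v)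
                               (firstIndex-resp (words n m) {reverse u} {reverse v} (∼-reverse {u} {v} u∼v))

  achiral-firstIndex : ∀ {w} → w ∈ words n m →
    (firstIndex (words n m) w ≡ᵇ firstIndex (words n m) (reverse w)) ≡ sameOrbit w (reverse w)
  achiral-firstIndex {w} w∈ = ⇔→≡ (mk⇔
    (λ idx≡ → firstIndex-injective {words n m} {w} {reverse w} w∈ (isWord-∼-refl (∈-words⁻ w∈))
                (≡ᵇ⇒≡ _ _ (Equivalence.from T-≡ idx≡)))
    (λ w∼rw → Equivalence.to T-≡ (≡⇒≡ᵇ _ _ (firstIndex-resp (words n m) {w} {reverse w} w∼rw))))

  chirality-split : ∀ {w} → w ∈ words n m → 1 ≡ achiral w + leftHanded w + leftHanded (reverse w)
  chirality-split {w} w∈ = begin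
    1                                                  ≡⟨ trichotomy-𝟙 (idx w) (idx (reverse w)) ⟨
    𝟙 (idx w ≡ᵇ idx (reverse w)) + leftHanded w + 𝟙 (idx (reverse w) <ᵇ idx w)
      ≡⟨ cong₂ (λ a i → 𝟙 a + leftHanded w + 𝟙 (idx (reverse w) <ᵇ i))
               (achiral-firstIndex w∈) (cong idx (sym (reverse-involutive w))) ⟩
    achiral w + leftHanded w + leftHanded (reverse w)  ∎
    where
    idx = firstIndex (words n m)

  classSum-leftHanded∘reverse : classSum (leftHanded ∘ reverse) [] (words n m) ≡ classSum leftHanded [] (words n m)
  classSum-leftHanded∘reverse = *-cancelˡ-≡ _ _ n (begin
    n * classSum (leftHanded ∘ reverse) [] Ws
      ≡⟨ classSum-by-stabSize (leftHanded ∘ reverse) (λ {u} {v} u∼v → leftHanded-invariant (∼-reverse {u} {v} u∼v)) ⟩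
    ∑[ w ∈ Ws ] (leftHanded (reverse w) * stabSize n w)
      ≡⟨ ∑-cong Ws (λ {w} _ → cong (leftHanded (reverse w) *_) (stabSize-reverse n w)) ⟨
    ∑[ w ∈ Ws ] (leftHanded (reverse w) * stabSize n (reverse w))
      ≡⟨ ∑-words-bijection {n} {m} reverse reverse isWord-reverse isWord-reverse
           (λ {w} _ → reverse-involutive w) (λ {w} _ → reverse-involutive w) (λ w → leftHanded w * stabSize n w) ⟩
    ∑[ w ∈ Ws ] (leftHanded w * stabSize n w)
      ≡⟨ classSum-by-stabSize leftHanded leftHanded-invariant ⟨
    n * classSum leftHanded [] Ws  ∎)
    where
    Ws = words n m

  countOrbits-chirality : countOrbits (words n m) ≡ classSum achiral [] (words n m) + 2 * classSum leftHanded [] (words n m)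
  countOrbits-chirality = begin
    countOrbits Ws                                                          ≡⟨ countOrbits≡classSum Ws ⟩
    classSum (λ _ → 1) [] Ws                                                ≡⟨ classSum-cong [] Ws chirality-split ⟩
    classSum (λ w → achiral w + leftHanded w + leftHanded (reverse w)) [] Ws
      ≡⟨ classSum-+ _ (leftHanded ∘ reverse) [] Ws ⟩
    classSum (λ w → achiral w + leftHanded w) [] Ws + classSum (leftHanded ∘ reverse) [] Ws
      ≡⟨ cong₂ _+_ (classSum-+ achiral leftHanded [] Ws) classSum-leftHanded∘reverse ⟩
    a + l + l                                                               ≡⟨ +-assoc a l l ⟩
    a + (l + l)                                                             ≡⟨ cong (λ x → a + (l + x)) (+-identityʳ l) ⟨
    a + 2 * l                                                               ∎
    where
    Ws = words n m
    a  = classSum achiral [] Ws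
    l  = classSum leftHanded [] Ws

  achiral-count : n * classSum achiral [] (words n m) ≡ ∑[ j ∈ upTo n ] mirrorCount n m j
  achiral-count = begin
    n * classSum achiral [] Ws
      ≡⟨ classSum-by-stabSize achiral (λ {u} {v} → achiral-invariant {u} {v}) ⟩
    ∑[ w ∈ Ws ] (achiral w * stabSize n w)
      ≡⟨ ∑-cong Ws (λ {w} w∈ → orbit-multiplicity {n} {w} (reverse w) (proj₁ (∈-words⁻ w∈))) ⟨
    ∑[ w ∈ Ws ] ∑[ j ∈ upTo n ] 𝟙 (shiftⁿ j w == reverse w)
      ≡⟨ ∑-comm Ws (upTo n) (λ w j → 𝟙 (shiftⁿ j w == reverse w)) ⟩
    ∑[ j ∈ upTo n ] mirrorCount n m j                                   ∎
    where
    Ws = words n m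

twice-achiral : ∀ h m → 2 * classSum achiral [] (words (suc h * 2) m) ≡ (1 + m) * m ^ suc h
twice-achiral h m = *-cancelˡ-≡ _ _ H (begin
  H * (2 * classSum achiral [] (words n m))          ≡⟨ *-assoc H 2 (classSum achiral [] (words n m)) ⟨
  n * classSum achiral [] (words n m)                ≡⟨ achiral-count n m ⟩
  ∑[ j ∈ upTo n ] mirrorCount n m j
    ≡⟨ ∑-upTo-2-periodic H (mirrorCount n m) (mirrorCount-periodic (suc (h * 2)) m) ⟩
  H * (mirrorCount n m 0 + mirrorCount n m 1)
    ≡⟨ cong (λ c → H * (mirrorCount n m 0 + c)) (mirrorCount-1 (suc (h * 2)) m) ⟩
  H * (palindromes n + m * palindromes (suc (h * 2)))
    ≡⟨ cong₂ (λ c c′ → H * (c + m * c′)) (cong palindromes (cong suc odd≡)) (cong palindromes odd≡) ⟩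
  H * (palindromes (H + H) + m * palindromes (h + H))
    ≡⟨ cong₂ (λ c c′ → H * (c + m * c′)) (∑-palindromes H m z≤n) (∑-palindromes h m (s≤s z≤n)) ⟩
  H * (m ^ H + m * m ^ H)                            ∎)
  where
  H = suc h
  n = H * 2
  palindromes : ℕ → ℕ
  palindromes L = ∑[ w ∈ words L m ] 𝟙 (w == reverse w)
  odd≡ : suc (h * 2) ≡ h + H
  odd≡ = trans (cong suc (trans (*-comm h 2) (cong (h +_) (+-identityʳ h)))) (sym (+-suc h h))

achiral-even : ∀ h m → m % 4 ≡ 3 → 2 ∣ classSum achiral [] (words (suc h * 2) m)
achiral-even h m m%4≡3 = divides ((1 + t) * m ^ suc h) (*-cancelˡ-≡ _ _ 2 (begin
  2 * classSum achiral [] (words (suc h * 2) m)   ≡⟨ twice-achiral h m ⟩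
  (1 + m) * m ^ suc h                             ≡⟨ cong (λ x → (1 + x) * m ^ suc h) (m≡m%n+[m/n]*n m 4) ⟩
  (1 + (m % 4 + t * 4)) * m ^ suc h               ≡⟨ cong (λ r → (1 + (r + t * 4)) * m ^ suc h) m%4≡3 ⟩
  (1 + (3 + t * 4)) * m ^ suc h                   ≡⟨ expand t (m ^ suc h) ⟩
  2 * ((1 + t) * m ^ suc h * 2)                   ∎))
  where
  t = m / 4
  expand : ∀ t p → (1 + (3 + t * 4)) * p ≡ 2 * ((1 + t) * p * 2)
  expand = solve-∀

lemma4p4 : (n m : ℕ) → m % 4 ≡ 3 → 2 ≤ n → 2 ∣ n → 2 ∣ N n m
lemma4p4 .(zero * 2)  m _      ()  (divides zero refl)
lemma4p4 .(suc h * 2) m m%4≡3 _ (divides (suc h) refl) =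
  subst (2 ∣_) (sym (countOrbits-chirality (suc h * 2) m))
    (∣m∣n⇒∣m+n (achiral-even h m m%4≡3) (m∣m*n (classSum (leftHanded n m) [] (words n m))))
  where
  n = suc h * 2
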